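{- For every integer $n\ge 3$, $\frac{(n-2)!}{1!}\cdot 1+\frac{(n-1)!}{2!}\cdot 2\equiv 0\pmod n$. In particular, letting $H_2(n):=1+\sum_{i=1}^{n-1}\frac{(n+i-3)!}{i!}\,i^2$ for $n\ge 3$, we have: $n$ is prime if and only if $n\mid H_2(n)$.
   Context: In the paper this is stated as $U_1(n)\equiv 0\pmod n$, where $U_1(n):=\frac{(n-2)!}{1!}1^1+\frac{(n-1)!}{2!}2^1$ for $n$ with $1\le n-2$. -}

module Defs where

open import Data.Nat using (ℕ; zero; suc; _+_; _*_; _∸_; _^_; _!)
open import Data.Nat.DivMod using (_/_)
open import Data.Nat.Properties using (_!≢0)

-- a! / b!  (exact quotient when b ≤ a); divisor b! is nonzero
_!/_! : ℕ → ℕ → ℕ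
a !/ b ! = (a !) / (b !) where instance _ = b !≢0

Σ₁ : ℕ → (ℕ → ℕ) → ℕ
Σ₁ zero    f = 0
Σ₁ (suc m) f = Σ₁ m f + f (suc m)

U₁ : ℕ → ℕ
U₁ n = (n ∸ 2) !/ 1 ! * (1 ^ 1) + (n ∸ 1) !/ 2 ! * (2 ^ 1)

H₂ : ℕ → ℕ
H₂ n = 1 + Σ₁ (n ∸ 1) (λ i → (n + i ∸ 3) !/ i ! * (i ^ 2))

module Submission where

-- For n = m + 3 write X = (n-2)! = (m+1)!.
--  * U₁(n) = (n-2)! + (n-1)! = X + (n-1)·X = n·X, so n ∣ U₁(n).
--  * In H₂(n) = 1 + Σ_{i=1}^{n-1} (n+i-3)!/i! · i², every term with i ≥ 3 is a
--    product of the consecutive integers i+1, …, n+i-3, a range that contains n;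
--    so modulo n only 1 + X + 2·(n-1)! = 1 + (2n-1)·X survives.
--  * If n is prime, Wilson's theorem in the form (p-2)! ≡ 1 (mod p) makes this
--    ≡ 1 + 2n - 1 ≡ 0.  If n is composite, a proper divisor d (necessarily
--    2 ≤ d ≤ n-2) divides X and every other term, hence would divide 1.
-- The stdlib has no Wilson theorem, so the file first proves it by the pairing
-- argument: in a duplicate-free list closed under taking (unique, distinct)
-- inverses modulo p the product is 1 (mod p); for p prime the list [2, …, p-2]
-- is such a list, and its product is (p-2)!.

open import Defs
open import Data.List using (List; []; _∷_; length; filter)
open import Data.List.Membership.Propositional using (_∈_)
open import Data.List.Membership.Propositional.Properties using (∈-filter⁺; ∈-filter⁻)
open import Data.List.Properties using (filter-accept; filter-reject; filter-all; filter-notAll)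
open import Data.List.Relation.Unary.All as All using ()
open import Data.List.Relation.Unary.AllPairs as AllPairs using ([]; _∷_)
open import Data.List.Relation.Unary.Any as Any using (here; there)
open import Data.List.Relation.Unary.Unique.Propositional using (Unique)
import Data.List.Relation.Unary.Unique.Propositional.Properties as Unique
open import Data.Nat
open import Data.Nat.Coprimality using (prime⇒coprime; coprime-Bézout)
open import Data.Nat.DivMod
open import Data.Nat.Divisibility
open import Data.Nat.GCD using (module Bézout)
open import Data.Nat.Induction using (<-wellFounded)
open import Data.Nat.ListAction using (product)
open import Data.Nat.Primality using (Prime; prime; composite; euclidsLemma)
open import Data.Nat.Properties
open import Algebra.Properties.CommutativeSemigroup *-commutativeSemigroup using (x∙yz≈y∙xz)
open import Data.Nat.Tactic.RingSolver using (solve-∀)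
open import Data.Empty using (⊥)
open import Data.Product using (∃-syntax; _×_; _,_; proj₁; proj₂)
open import Data.Sum using (_⊎_; inj₁; inj₂; [_,_]′)
open import Function using (_∘_)
open import Function.Bundles using (_⇔_; mk⇔)
open import Induction.WellFounded using (Acc; acc)
open import Relation.Binary.PropositionalEquality
open import Relation.Nullary using (Dec; ¬?; contradiction)

other? : ∀ a z → Dec (z ≢ a)
other? a z = ¬? (z ≟ a)

remove : ℕ → List ℕ → List ℕ
remove a = filter (other? a)

product-remove : ∀ {a xs} → Unique xs → a ∈ xs → product xs ≡ a * product (remove a xs)
product-remove {a} {a ∷ zs} (a∉zs ∷ _) (here refl) = cong (a *_) (begin
  product zs                   ≡⟨ cong product (filter-all (other? a) (All.map (_∘ sym) a∉zs)) ⟨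
  product (remove a zs)        ≡⟨ cong product (filter-reject (other? a) (λ a≢a → a≢a refl)) ⟨
  product (remove a (a ∷ zs))  ∎)
  where open ≡-Reasoning
product-remove {a} {z ∷ zs} (z∉zs ∷ u) (there a∈zs) = begin
  z * product zs                   ≡⟨ cong (z *_) (product-remove u a∈zs) ⟩
  z * (a * product (remove a zs))  ≡⟨ x∙yz≈y∙xz z a _ ⟩
  a * (z * product (remove a zs))  ≡⟨ cong (a *_) (cong product (filter-accept (other? a) (All.lookup z∉zs a∈zs))) ⟨
  a * product (remove a (z ∷ zs))  ∎
  where open ≡-Reasoning

module Pairing (p : ℕ) .{{_ : NonZero p}} where

  record Inverse (x y : ℕ) : Set where
    constructor inverse
    field residue : x * y % p ≡ 1 % p

  open Inverse public

  inverse-sym : ∀ {x y} → Inverse x y → Inverse y x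
  inverse-sym {x} {y} (inverse xy≡1) = inverse (trans (cong (_% p) (*-comm y x)) xy≡1)

  inverse-cancel : ∀ {x y} m → Inverse x y → x * (y * m) % p ≡ m % p
  inverse-cancel {x} {y} m (inverse xy≡1) = begin
    x * (y * m) % p              ≡⟨ cong (_% p) (*-assoc x y m) ⟨
    x * y * m % p                ≡⟨ %-distribˡ-* (x * y) m p ⟩
    (x * y % p) * (m % p) % p    ≡⟨ cong (λ t → t * (m % p) % p) xy≡1 ⟩
    (1 % p) * (m % p) % p        ≡⟨ %-distribˡ-* 1 m p ⟨
    1 * m % p                    ≡⟨ cong (_% p) (*-identityˡ m) ⟩
    m % p                        ∎
    where open ≡-Reasoning

  -- Among reduced residues an inverse is unique: y ≡ y(xz) = z(xy) ≡ z.
  inverse-unique : ∀ {x y z} → y < p → z < p → Inverse x y → Inverse x z → y ≡ z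
  inverse-unique {x} {y} {z} y<p z<p inv-y inv-z = begin
    y                ≡⟨ m<n⇒m%n≡m y<p ⟨
    y % p            ≡⟨ inverse-cancel y inv-z ⟨
    x * (z * y) % p  ≡⟨ cong (λ t → x * t % p) (*-comm z y) ⟩
    x * (y * z) % p  ≡⟨ inverse-cancel z inv-y ⟩
    z % p            ≡⟨ m<n⇒m%n≡m z<p ⟩
    z                ∎
    where open ≡-Reasoning

  Paired : List ℕ → Set
  Paired xs = ∀ {x} → x ∈ xs → ∃[ y ] y ∈ xs × y ≢ x × Inverse x y

  InversesUnique : List ℕ → Set
  InversesUnique xs = ∀ {x y z} → x ∈ xs → y ∈ xs → z ∈ xs → Inverse x y → Inverse x z → y ≡ z

  -- Deleting a pair x, y of mutual inverses from a paired list keeps it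
  -- paired: a remaining element z cannot be partnered with x or y, since then
  -- z would be the unique inverse y of x, or x the unique inverse z of y.
  paired-remove : ∀ {x y rest} → Unique (x ∷ rest) → Paired (x ∷ rest) → InversesUnique (x ∷ rest) →
                  y ∈ x ∷ rest → Inverse x y → Paired (remove y rest)
  paired-remove {x} {y} {rest} (x∉rest ∷ _) pr iu y∈xs inv-xy {z} z∈ with ∈-filter⁻ (other? y) z∈
  ... | z∈rest , z≢y with pr (there z∈rest)
  ... | w , here refl , w≢z , inv-zx =
        contradiction (sym (iu (here refl) y∈xs (there z∈rest) inv-xy (inverse-sym inv-zx))) z≢y
  ... | w , there w∈rest , w≢z , inv-zw = w , ∈-filter⁺ (other? y) w∈rest w≢y , w≢z , inv-zw
    where
    w≢y : w ≢ y
    w≢y refl = All.lookup x∉rest z∈rest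
                 (sym (iu y∈xs (there z∈rest) (here refl) (inverse-sym inv-zw) (inverse-sym inv-xy)))

  -- A duplicate-free paired list has product 1 modulo p: delete the first
  -- element x together with its partner y, which cancel, and recurse.
  paired-product : ∀ {xs} → Unique xs → Paired xs → InversesUnique xs → product xs % p ≡ 1 % p
  paired-product u pr iu = go _ u pr iu (<-wellFounded _)
    where
    go : ∀ xs → Unique xs → Paired xs → InversesUnique xs → Acc _<_ (length xs) → product xs % p ≡ 1 % p
    go [] _ _ _ _ = refl
    go (x ∷ rest) u pr iu (acc rec) with pr (here refl)
    ... | y , y∈xs , y≢x , inv-xy = begin
      x * product rest % p         ≡⟨ cong (λ t → x * t % p) (product-remove (AllPairs.tail u) y∈rest) ⟩
      x * (y * product rest′) % p  ≡⟨ inverse-cancel (product rest′) inv-xy ⟩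
      product rest′ % p            ≡⟨ go rest′ unique′ (paired-remove u pr iu y∈xs inv-xy) iu′ (rec shorter) ⟩
      1 % p                        ∎
      where
      open ≡-Reasoning
      rest′ = remove y rest
      y∈rest : y ∈ rest
      y∈rest = drop-head y∈xs
        where
        drop-head : y ∈ x ∷ rest → y ∈ rest
        drop-head (here y≡x)     = contradiction y≡x y≢x
        drop-head (there y∈rest) = y∈rest
      shorter : length rest′ < suc (length rest)
      shorter = m<n⇒m<1+n (filter-notAll (other? y) rest (Any.map (λ y≡z y≢z → y≢z (sym y≡z)) y∈rest))
      unique′ : Unique rest′
      unique′ = Unique.filter⁺ (other? y) (AllPairs.tail u)
      iu′ : InversesUnique rest′
      iu′ x∈ y∈ z∈ = iu (⊆xs x∈) (⊆xs y∈) (⊆xs z∈)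
        where
        ⊆xs : ∀ {z} → z ∈ rest′ → z ∈ x ∷ rest
        ⊆xs z∈ = there (proj₁ (∈-filter⁻ (other? y) z∈))

interior : ℕ → List ℕ
interior zero          = []
interior (suc zero)    = []
interior (suc (suc k)) = 2 + k ∷ interior (suc k)

∈-interior⁻ : ∀ {x k} → x ∈ interior k → 2 ≤ x × x ≤ k
∈-interior⁻ {k = suc (suc k)} (here refl) = s≤s (s≤s z≤n) , ≤-refl
∈-interior⁻ {k = suc (suc k)} (there x∈) with ∈-interior⁻ x∈
... | 2≤x , x≤k = 2≤x , m≤n⇒m≤1+n x≤k

∈-interior⁺ : ∀ k {x} → 2 ≤ x → x ≤ k → x ∈ interior k
∈-interior⁺ zero          2≤x x≤0 = contradiction (≤-trans 2≤x x≤0) λ ()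
∈-interior⁺ (suc zero)    2≤x x≤1 = contradiction (≤-trans 2≤x x≤1) λ { (s≤s ()) }
∈-interior⁺ (suc (suc k)) 2≤x x≤k =
  [ (λ x<k → there (∈-interior⁺ (suc k) 2≤x (≤-pred x<k))) , here ]′ (m≤n⇒m<n∨m≡n x≤k)

-- interior k is strictly decreasing, hence duplicate-free.
interior-unique : ∀ k → Unique (interior k)
interior-unique zero          = []
interior-unique (suc zero)    = []
interior-unique (suc (suc k)) = All.tabulate head-fresh ∷ interior-unique (suc k)
  where
  head-fresh : ∀ {z} → z ∈ interior (suc k) → 2 + k ≢ z
  head-fresh z∈ refl = 1+n≰n (proj₂ (∈-interior⁻ z∈))

product-interior : ∀ k → product (interior k) ≡ k !
product-interior zero          = refl
product-interior (suc zero)    = refl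
product-interior (suc (suc k)) = cong ((2 + k) *_) (product-interior (suc k))

multiple-below : ∀ {d y} → d ∣ y → y < d → y ≡ 0
multiple-below {y = zero}  _   _   = refl
multiple-below {y = suc _} d∣y y<d = contradiction (∣⇒≤ d∣y) (<⇒≱ y<d)

-- Wilson's theorem for the modulus p = r + 2, in the form (p-2)! ≡ 1 (mod p).
module Wilson (r : ℕ) where

  open Pairing (2 + r)

  inverse-one : Inverse 1 1
  inverse-one = inverse refl

  inverse-last : Inverse (1 + r) (1 + r)
  inverse-last = inverse (trans (cong (_% (2 + r)) (square r)) ([m+kn]%n≡m%n 1 r (2 + r)))
    where
    square : ∀ r → (1 + r) * (1 + r) ≡ 1 + r * (2 + r)
    square = solve-∀

  inverse-% : ∀ {x y} → Inverse x y → Inverse x (y % (2 + r))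
  inverse-% {x} {y} (inverse xy≡1) = inverse (begin
    x * (y % p) % p            ≡⟨ %-distribˡ-* x (y % p) p ⟩
    (x % p) * (y % p % p) % p  ≡⟨ cong (λ t → (x % p) * t % p) (m%n%n≡m%n y p) ⟩
    (x % p) * (y % p) % p      ≡⟨ %-distribˡ-* x y p ⟨
    x * y % p                  ≡⟨ xy≡1 ⟩
    1                          ∎)
    where
    open ≡-Reasoning
    p = 2 + r

  inverse-quotient : ∀ {x y} → Inverse x y → x * y ≡ 1 + (x * y / (2 + r)) * (2 + r)
  inverse-quotient {x} {y} (inverse xy≡1) = trans (m≡m%n+[m/n]*n (x * y) (2 + r)) (cong (_+ (x * y / (2 + r)) * (2 + r)) xy≡1)

  module _ (p-prime : Prime (2 + r)) where

    -- By Bézout, every nonzero residue has an inverse among the nonzero residues.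
    inverse-exists : ∀ {x} → 1 ≤ x → x < 2 + r → ∃[ y ] 1 ≤ y × y < 2 + r × Inverse x y
    inverse-exists {x} 1≤x x<p =
      reduce (bézout-inverse (coprime-Bézout (prime⇒coprime p-prime {{>-nonZero 1≤x}} x<p)))
      where
      p = 2 + r
      bézout-inverse : Bézout.Identity 1 p x → ∃[ y ] Inverse x y
      bézout-inverse (Bézout.+- a b 1+bx≡ap) = b * (1 + r) , inverse (begin
        x * (b * (1 + r)) % p                  ≡⟨ [m+kn]%n≡m%n (x * (b * (1 + r))) a p ⟨
        (x * (b * (1 + r)) + a * p) % p        ≡⟨ cong (λ t → (x * (b * (1 + r)) + t) % p) 1+bx≡ap ⟨
        (x * (b * (1 + r)) + (1 + b * x)) % p  ≡⟨ cong (_% p) (regroup x b r) ⟩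
        (1 + (b * x) * p) % p                  ≡⟨ [m+kn]%n≡m%n 1 (b * x) p ⟩
        1                                      ∎)
        where
        open ≡-Reasoning
        regroup : ∀ x b r → x * (b * (1 + r)) + (1 + b * x) ≡ 1 + (b * x) * (2 + r)
        regroup = solve-∀
      bézout-inverse (Bézout.-+ a b 1+ap≡bx) = b , inverse (begin
        x * b % p        ≡⟨ cong (_% p) (*-comm x b) ⟩
        b * x % p        ≡⟨ cong (_% p) 1+ap≡bx ⟨
        (1 + a * p) % p  ≡⟨ [m+kn]%n≡m%n 1 a p ⟩
        1                ∎)
        where open ≡-Reasoning
      reduce : ∃[ y ] Inverse x y → ∃[ y ] 1 ≤ y × y < p × Inverse x y
      reduce (y , inv) = y % p , n≢0⇒n>0 nonzero , m%n<n y p , inverse-% inv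
        where
        nonzero : y % p ≢ 0
        nonzero y%p≡0 = 0≢1+n (begin
          0                ≡⟨ cong (_% p) (*-zeroʳ x) ⟨
          x * 0 % p        ≡⟨ cong (λ t → x * t % p) y%p≡0 ⟨
          x * (y % p) % p  ≡⟨ residue (inverse-% inv) ⟩
          1                ∎)
          where open ≡-Reasoning

    -- The only self-inverse nonzero residues are 1 and p-1, as p ∣ (x-1)(x+1).
    self-inverse : ∀ {x} → 1 ≤ x → x < 2 + r → Inverse x x → x ≡ 1 ⊎ x ≡ 1 + r
    self-inverse {suc y} _ x<p inv with euclidsLemma y (2 + y) p-prime (divides (suc y * suc y / (2 + r)) factored)
      where
      factored : y * (2 + y) ≡ (suc y * suc y / (2 + r)) * (2 + r)
      factored = suc-injective (trans (square y) (inverse-quotient inv))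
        where
        square : ∀ y → 1 + y * (2 + y) ≡ suc y * suc y
        square = solve-∀
    ... | inj₁ p∣y   = inj₁ (cong suc (multiple-below p∣y (<-trans (n<1+n y) x<p)))
    ... | inj₂ p∣2+y = inj₂ (cong suc (+-cancelˡ-≡ 2 y r (≤-antisym x<p (∣⇒≤ p∣2+y))))

    interior-paired : Paired (interior r)
    interior-paired {x} x∈ = partner (inverse-exists (≤-trans (n≤1+n 1) 2≤x) x<p)
      where
      2≤x = proj₁ (∈-interior⁻ x∈)
      x≤r = proj₂ (∈-interior⁻ x∈)
      x<p : x < 2 + r
      x<p = s≤s (m≤n⇒m≤1+n x≤r)
      x≢1 : x ≢ 1
      x≢1 refl = 1+n≰n 2≤x
      x≢1+r : x ≢ 1 + r
      x≢1+r refl = 1+n≰n x≤r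
      -- the inverse y of x is neither 1 nor p-1 (their inverses are themselves), nor x
      partner : ∃[ y ] 1 ≤ y × y < 2 + r × Inverse x y → ∃[ y ] y ∈ interior r × y ≢ x × Inverse x y
      partner (y , 1≤y , y<p , inv) = y , ∈-interior⁺ r 2≤y y≤r , y≢x , inv
        where
        y≢1 : y ≢ 1
        y≢1 refl = x≢1 (inverse-unique x<p (s≤s (s≤s z≤n)) (inverse-sym inv) inverse-one)
        y≢1+r : y ≢ 1 + r
        y≢1+r refl = x≢1+r (inverse-unique x<p ≤-refl (inverse-sym inv) inverse-last)
        y≢x : y ≢ x
        y≢x refl = [ x≢1 , x≢1+r ]′ (self-inverse 1≤y y<p inv)
        2≤y : 2 ≤ y
        2≤y = ≤∧≢⇒< 1≤y (y≢1 ∘ sym)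
        y≤r : y ≤ r
        y≤r = ≤-pred (≤∧≢⇒< (≤-pred y<p) y≢1+r)

    -- Members of [2, …, p-2] are reduced residues, so their inverses are unique.
    interior-inverses-unique : InversesUnique (interior r)
    interior-inverses-unique _ y∈ z∈ = inverse-unique (below-p y∈) (below-p z∈)
      where
      below-p : ∀ {z} → z ∈ interior r → z < 2 + r
      below-p z∈ = s≤s (m≤n⇒m≤1+n (proj₂ (∈-interior⁻ z∈)))

    wilson : r ! % (2 + r) ≡ 1
    wilson = subst (λ t → t % (2 + r) ≡ 1) (product-interior r)
               (paired-product (interior-unique r) interior-paired interior-inverses-unique)

!/!*! : ∀ a {b} → b ≤ a → (a !/ b !) * b ! ≡ a !
!/!*! a {b} b≤a = m/n*n≡m (m≤n⇒m!∣n! b≤a)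
  where instance _ = b !≢0

-- Every d with b < d ≤ a divides a!/b! = (b+1)(b+2)⋯a, since d·b! ∣ d! ∣ a!.
∣-!/! : ∀ {a b d} → b < d → d ≤ a → d ∣ (a !/ b !)
∣-!/! {a} {b} {suc d} b<d d≤a =
  m*n∣o⇒m∣o/n (suc d) (b !) {{b !≢0}}
    (∣-trans (*-monoʳ-∣ (suc d) (m≤n⇒m!∣n! (≤-pred b<d))) (m≤n⇒m!∣n! d≤a))

∣-! : ∀ {d k} → 1 ≤ d → d ≤ k → d ∣ k !
∣-! {suc d} _ d≤k = ∣-trans (m∣m*n (d !)) (m≤n⇒m!∣n! d≤k)

-- A nontrivial proper divisor d of k + 2 is at most k, as d ∤ d + 1.
proper-divisor-≤ : ∀ {d k} → d ∣ 2 + k → d < 2 + k → 2 ≤ d → d ≤ k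
proper-divisor-≤ {d} {k} d∣n d<n 2≤d with m≤n⇒m<n∨m≡n (≤-pred d<n)
... | inj₁ d<1+k = ≤-pred d<1+k
... | inj₂ refl  = contradiction (∣1⇒≡1 (∣m+n∣m⇒∣n (subst (d ∣_) (+-comm 1 d) d∣n) ∣-refl))
                                (λ d≡1 → 1+n≰n (subst (2 ≤_) d≡1 2≤d))

Σ₁-split₂ : ∀ j f → Σ₁ (2 + j) f ≡ f 1 + f 2 + Σ₁ j (λ i → f (2 + i))
Σ₁-split₂ zero    f = sym (+-identityʳ (f 1 + f 2))
Σ₁-split₂ (suc j) f = trans (cong (_+ f (3 + j)) (Σ₁-split₂ j f)) (+-assoc (f 1 + f 2) _ _)

Σ₁-∣ : ∀ j f {d} → (∀ i → 1 ≤ i → i ≤ j → d ∣ f i) → d ∣ Σ₁ j f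
Σ₁-∣ zero    f h = _ ∣0
Σ₁-∣ (suc j) f h = ∣m∣n⇒∣m+n (Σ₁-∣ j f (λ i 1≤i i≤j → h i 1≤i (m≤n⇒m≤1+n i≤j))) (h (suc j) (s≤s z≤n) ≤-refl)

module AtLeastThree (m : ℕ) where

  X : ℕ
  X = (1 + m) !

  U₁-closed : U₁ (3 + m) ≡ (3 + m) * X
  U₁-closed = cong₂ _+_ (!/!*! (1 + m) (s≤s z≤n)) (!/!*! (2 + m) (s≤s (s≤s z≤n)))

  U₁-divisible : (3 + m) ∣ U₁ (3 + m)
  U₁-divisible = divides X (trans U₁-closed (*-comm (3 + m) X))

  term : ℕ → ℕ
  term i = (m + i) !/ i ! * (i ^ 2)

  tail-sum : ℕ
  tail-sum = Σ₁ m (λ i → term (2 + i))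

  -- Each of them is divisible by n, as n lies in the range i+1, …, n+i-3.
  tail-divisible : (3 + m) ∣ tail-sum
  tail-divisible = Σ₁-∣ m _ λ i 1≤i i≤m →
    ∣m⇒∣m*n ((2 + i) ^ 2) (∣-!/! (s≤s (s≤s (s≤s i≤m)))
      (subst (3 + m ≤_) (+-comm (2 + i) m) (+-monoˡ-≤ m (s≤s (s≤s 1≤i)))))

  H₂-split : H₂ (3 + m) ≡ 1 + (X + (2 + m) ! * 2 + tail-sum)
  H₂-split = cong (1 +_) (begin
    Σ₁ (2 + m) term                   ≡⟨ Σ₁-split₂ m term ⟩
    term 1 + term 2 + tail-sum        ≡⟨ cong (_+ tail-sum) (cong₂ _+_ first second) ⟩
    X + (2 + m) ! * 2 + tail-sum      ∎)
    where
    open ≡-Reasoning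
    first : term 1 ≡ X
    first = trans (!/!*! (m + 1) (m≤n+m 1 m)) (cong _! (+-comm m 1))
    second : term 2 ≡ (2 + m) ! * 2
    second = begin
      ((m + 2) !/ 2 !) * (2 ! * 2)  ≡⟨ *-assoc ((m + 2) !/ 2 !) (2 !) 2 ⟨
      ((m + 2) !/ 2 !) * 2 ! * 2    ≡⟨ cong (_* 2) (!/!*! (m + 2) (m≤n+m 2 m)) ⟩
      (m + 2) ! * 2                 ≡⟨ cong (λ t → t ! * 2) (+-comm m 2) ⟩
      (2 + m) ! * 2                 ∎

  -- For prime n, Wilson gives X = 1 + q·n and the head is n·(2 + (2n-1)·q).
  prime⇒∣H₂ : Prime (3 + m) → (3 + m) ∣ H₂ (3 + m)
  prime⇒∣H₂ n-prime = subst (3 + m ∣_) (sym (trans H₂-split (sym (+-assoc 1 _ tail-sum))))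
                      (∣m∣n⇒∣m+n (divides (2 + (5 + 2 * m) * q) head) tail-divisible)
    where
    q = X / (3 + m)
    X≡1+qn : X ≡ 1 + q * (3 + m)
    X≡1+qn = trans (m≡m%n+[m/n]*n X (3 + m)) (cong (_+ q * (3 + m)) (Wilson.wilson (1 + m) n-prime))
    expand : ∀ m q → 1 + ((1 + q * (3 + m)) + (2 + m) * (1 + q * (3 + m)) * 2) ≡ (2 + (5 + 2 * m) * q) * (3 + m)
    expand = solve-∀
    head : 1 + (X + (2 + m) ! * 2) ≡ (2 + (5 + 2 * m) * q) * (3 + m)
    head = trans (cong (λ t → 1 + (t + (2 + m) * t * 2)) X≡1+qn) (expand m q)

  -- A proper divisor d of n lies in [2, n-2], so divides X and every term but
  -- the leading 1; if n ∣ H₂(n) it would divide 1.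
  ∣H₂⇒prime : (3 + m) ∣ H₂ (3 + m) → Prime (3 + m)
  ∣H₂⇒prime n∣H = prime λ { (composite {d} d<n d∣n) → no-divisor d<n d∣n }
    where
    no-divisor : ∀ {d} .{{_ : NonTrivial d}} → d < 3 + m → d ∣ 3 + m → ⊥
    no-divisor {d} d<n d∣n = nonTrivial⇒≢1 {d} (∣1⇒≡1 (∣m+n∣m⇒∣n d∣rest+1 d∣rest))
      where
      2≤d = nonTrivial⇒n>1 d
      d∣X : d ∣ X
      d∣X = ∣-! (≤-trans (n≤1+n 1) 2≤d) (proper-divisor-≤ d∣n d<n 2≤d)
      d∣rest : d ∣ X + (2 + m) ! * 2 + tail-sum
      d∣rest = ∣m∣n⇒∣m+n (∣m∣n⇒∣m+n d∣X (∣m⇒∣m*n 2 (∣n⇒∣m*n (2 + m) d∣X))) (∣-trans d∣n tail-divisible)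
      d∣rest+1 : d ∣ X + (2 + m) ! * 2 + tail-sum + 1
      d∣rest+1 = subst (d ∣_) (trans H₂-split (+-comm 1 _)) (∣-trans d∣n n∣H)

from-three : {P : ℕ → Set} → (∀ m → P (3 + m)) → ∀ n → 3 ≤ n → P n
from-three h _ (s≤s (s≤s (s≤s {n = m} _))) = h m

mainTheorem8 : ((n : ℕ) → 3 ≤ n → n ∣ U₁ n)
                 × ((n : ℕ) → 3 ≤ n → (Prime n ⇔ n ∣ H₂ n))
mainTheorem8 = from-three U₁-divisible , from-three H₂-criterion
  where
  open AtLeastThree
  H₂-criterion : ∀ m → Prime (3 + m) ⇔ (3 + m) ∣ H₂ (3 + m)
  H₂-criterion m = mk⇔ (prime⇒∣H₂ m) (∣H₂⇒prime m)
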